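{- There exist a formula $\phi\in\mathcal{L}_{PAFKy}$, an $\mathcal{S}5$ knowing-why model $\mathfrak{M}$ and a world $w$ of $\mathfrak{M}$ such that $(\mathfrak{M},w)\models\phi$ but $(\mathfrak{M}^F,w)\not\models\phi$, where $\mathfrak{M}^F$ is the factive companion of $\mathfrak{M}$.
   Context: Fix a countable set of agents $\mathcal{A}$ and a countably infinite set of atoms $\mathcal{P}$. $\mathcal{L}_{PAFKy}$: $\phi ::= p\mid\neg\phi\mid(\phi\land\phi)\mid K_a\phi\mid Ky_a\phi\mid[\phi]\phi$. $\Lambda$ is a fixed set of valid formulas (tautology ground). An $\mathcal{S}5$ knowing-why model is $\mathfrak{M}=\langle W,E,\{R_a\}_{a\in\mathcal{A}},\mathcal{E},V\rangle$ with $W\neq\emptyset$; $E$ nonempty, containing a designated $e$, closed under a binary operation $\cdot$; each $R_a$ an equivalence relation on $W$; $\mathcal{E}:E\times\mathcal{L}_{PAFKy}\to 2^W$ with $\mathcal{E}(e,\phi)=W$ for $\phi\in\Lambda$ and $\mathcal{E}(s,\phi\to\psi)\cap\mathcal{E}(t,\phi)\subseteq\mathcal{E}(s\cdot t,\psi)$; $V:\mathcal{P}\to 2^W$. Truth: $p,\neg,\land$ as usual; $K_a\phi$ holds at $w$ iff $\phi$ holds at all $R_a$-successors; $Ky_a\phi$ holds at $w$ iff $K_a\phi$ holds at $w$ and there is $t\in E$ with $v\in\mathcal{E}(t,\phi)$ for all $v$ with $(w,v)\in R_a$; $(\mathfrak{M},w)\models[\phi]\psi$ iff $(\mathfrak{M},w)\models\phi$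 implies $(\mathfrak{M}|\phi,w)\models\psi$, where $\mathfrak{M}|\phi$ restricts $W$ to $W'=\{w\mid(\mathfrak{M},w)\models\phi\}$, $R_a$ to $R_a\cap(W'\times W')$, $V(p)$ to $V(p)\cap W'$, and $\mathcal{E}(t,\chi)$ to $\mathcal{E}(t,\chi)\cap W'$, keeping $E$. The factive companion $\mathfrak{M}^F$ is $\mathfrak{M}$ with $\mathcal{E}$ replaced by $\mathcal{E}^F(t,\phi)=\mathcal{E}(t,\phi)\setminus\{w\in W\mid(\mathfrak{M},w)\not\models\phi\}$. -}

module Defs where

open import Data.Nat using (ℕ)
open import Data.Product using (Σ; _×_; _,_; proj₁; proj₂)
open import Relation.Nullary using (¬_)
open import Relation.Binary.Core using (Rel)
open import Relation.Binary.Structures using (IsEquivalence)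
open import Function.Definitions using (Injective)
open import Relation.Binary.PropositionalEquality using (_≡_)

Countable : Set → Set
Countable A = Σ (A → ℕ) λ f → Injective _≡_ _≡_ f

Atom : Set
Atom = ℕ

data Fm (Agent : Set) : Set where
  atom : Atom → Fm Agent
  ¬'_  : Fm Agent → Fm Agent
  _∧'_ : Fm Agent → Fm Agent → Fm Agent
  K    : Agent → Fm Agent → Fm Agent
  Ky   : Agent → Fm Agent → Fm Agent
  [_]_ : Fm Agent → Fm Agent → Fm Agent

_⇒'_ : ∀ {Agent} → Fm Agent → Fm Agent → Fm Agent
φ ⇒' ψ = ¬' (φ ∧' (¬' ψ))

-- Raw model data (no frame conditions); sets of worlds are predicates W → Set.
record PreModel (Agent : Set) : Set₁ where
  field
    W   : Set
    E   : Set
    e   : E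
    _·_ : E → E → E
    R   : Agent → Rel W _
    ℰ   : E → Fm Agent → W → Set
    V   : Atom → W → Set

restrictBy : ∀ {Agent} (M : PreModel Agent) → (PreModel.W M → Set) → PreModel Agent
restrictBy M P = record
  { W = Σ W P
  ; E = E
  ; e = e
  ; _·_ = _·_
  ; R = λ a u v → R a (proj₁ u) (proj₁ v)
  ; ℰ = λ t χ u → ℰ t χ (proj₁ u)
  ; V = λ p u → V p (proj₁ u)
  }
  where open PreModel M

_,_⊨_ : ∀ {Agent} (M : PreModel Agent) → PreModel.W M → Fm Agent → Set
M , w ⊨ atom p = PreModel.V M p w
M , w ⊨ (¬' φ) = ¬ (M , w ⊨ φ)
M , w ⊨ (φ ∧' ψ) = (M , w ⊨ φ) × (M , w ⊨ ψ)
M , w ⊨ K a φ = ∀ v → PreModel.R M a w v → M , v ⊨ φ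
M , w ⊨ Ky a φ = (∀ v → PreModel.R M a w v → M , v ⊨ φ)
               × Σ (PreModel.E M) (λ t → ∀ v → PreModel.R M a w v → PreModel.ℰ M t φ v)
M , w ⊨ ([ φ ] ψ) = (h : M , w ⊨ φ) → restrictBy M (λ v → M , v ⊨ φ) , (w , h) ⊨ ψ

_∣_ : ∀ {Agent} (M : PreModel Agent) → Fm Agent → PreModel Agent
M ∣ φ = restrictBy M (λ w → M , w ⊨ φ)

record IsS5KyModel {Agent : Set} (Λ : Fm Agent → Set) (M : PreModel Agent) : Set₁ where
  open PreModel M
  field
    W-nonempty : W
    R-equiv    : ∀ a → IsEquivalence (R a)
    ℰ-Λ        : ∀ φ → Λ φ → ∀ w → ℰ e φ w
    ℰ-app      : ∀ s t φ ψ w → ℰ s (φ ⇒' ψ) w → ℰ t φ w → ℰ (s · t) ψ w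

-- Factive companion: ℰ^F(t,φ) = ℰ(t,φ) ∖ {w | (M,w) ⊭ φ}.
factive : ∀ {Agent} → PreModel Agent → PreModel Agent
factive M = record
  { W = W ; E = E ; e = e ; _·_ = _·_ ; R = R
  ; ℰ = λ t φ w → ℰ t φ w × ¬ (¬ (M , w ⊨ φ))
  ; V = V }
  where open PreModel M

module Submission where

-- Witness: φ = [p] Ky_a K_a p, in the model with two worlds (p true / p false),
-- all worlds indistinguishable for every agent, and a single piece of evidence
-- that justifies every formula everywhere.
--
-- * In 𝔐, announcing p deletes the p-false world, so K_a p holds afterwards
--   at every remaining world (atoms are always known after being announced),
--   hence K_a K_a p, and the universal evidence turns this into Ky_a K_a p.
-- * In 𝔐^F, evidence for K_a p survives only at worlds where K_a p holds in 𝔐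
--   itself, before the announcement; but there the p-false world is still
--   accessible, so no world keeps that evidence and Ky_a K_a p fails after
--   announcing p.

open import Defs
open import Data.Bool using (Bool; true; false)
open import Data.Product using (Σ; _×_; _,_; proj₁; proj₂)
open import Data.Unit using (⊤; tt)
open import Relation.Nullary using (¬_)
open import Level using (0ℓ)
open import Relation.Binary.Core using (Rel)
open import Relation.Binary.Structures using (IsEquivalence)
open import Relation.Binary.PropositionalEquality using (_≡_; refl)

p-true-at-true : Atom → Bool → Set
p-true-at-true _ w = w ≡ true

module _ {Agent : Set} where

  universalEvidenceModel : (W : Set) → (Agent → Rel W 0ℓ) → (Atom → W → Set) → PreModel Agent
  universalEvidenceModel W R V = record
    { W = W ; E = ⊤ ; e = tt ; _·_ = λ _ _ → tt
    ; R = R ; ℰ = λ _ _ _ → ⊤ ; V = V }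

  universalEvidence-isS5 : (Λ : Fm Agent → Set) (W : Set) (R : Agent → Rel W 0ℓ) (V : Atom → W → Set) →
    W → (∀ a → IsEquivalence (R a)) → IsS5KyModel Λ (universalEvidenceModel W R V)
  universalEvidence-isS5 Λ W R V w R-equiv = record
    { W-nonempty = w
    ; R-equiv = R-equiv
    ; ℰ-Λ = λ _ _ _ → tt
    ; ℰ-app = λ _ _ _ _ _ _ _ → tt }

  announced-atom-known : (M : PreModel Agent) (p : Atom) (a : Agent) (u : PreModel.W (M ∣ atom p)) →
    (M ∣ atom p) , u ⊨ K a (atom p)
  announced-atom-known M p a u v _ = proj₂ v

  valid⇒known : (M : PreModel Agent) (a : Agent) (φ : Fm Agent) →
    (∀ v → M , v ⊨ φ) → ∀ w → M , w ⊨ K a φ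
  valid⇒known M a φ valid w v _ = valid v

  K⇒Ky-under-universal-evidence : (M : PreModel Agent) (a : Agent) (φ : Fm Agent) (t : PreModel.E M) →
    (∀ v → PreModel.ℰ M t φ v) → ∀ w → M , w ⊨ K a φ → M , w ⊨ Ky a φ
  K⇒Ky-under-universal-evidence M a φ t universal w known = known , t , λ v _ → universal v

  -- In any restriction of 𝔐^F, knowing why φ requires φ not to be refuted in
  -- the original 𝔐 at any accessible world: factive evidence is checked
  -- against truth in 𝔐, not in the restricted model.
  factive-Ky⇒prior-truth : (M : PreModel Agent) (P : PreModel.W M → Set) (a : Agent) (φ : Fm Agent)
    (u : Σ (PreModel.W M) P) → restrictBy (factive M) P , u ⊨ Ky a φ →
    ∀ v → PreModel.R M a (proj₁ u) (proj₁ v) → ¬ ¬ (M , proj₁ v ⊨ φ)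
  factive-Ky⇒prior-truth M P a φ u (_ , _ , evidence) v related = proj₂ (evidence v related)

  p₀ : Fm Agent
  p₀ = atom 0

  total : Agent → Rel Bool 0ℓ
  total _ _ _ = ⊤

  witnessModel : PreModel Agent
  witnessModel = universalEvidenceModel Bool total p-true-at-true

  total-isEquivalence : (a : Agent) → IsEquivalence (total a)
  total-isEquivalence a = record { refl = tt ; sym = λ _ → tt ; trans = λ _ _ → tt }

  p₀-unknown : (a : Agent) (w : Bool) → ¬ (witnessModel , w ⊨ K a p₀)
  p₀-unknown a w known with known false tt
  ... | ()

  announce-p₀-then-Ky-K : Agent → Fm Agent
  announce-p₀-then-Ky-K a = [ p₀ ] Ky a (K a p₀)

lemma4p4 : (Agent : Set) → Countable Agent → Agent → (Λ : Fm Agent → Set) →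
    Σ (Fm Agent) λ φ → Σ (PreModel Agent) λ M → IsS5KyModel Λ M × Σ (PreModel.W M) λ w →
    (M , w ⊨ φ) × ¬ (factive M , w ⊨ φ)
lemma4p4 Agent _ a Λ =
  announce-p₀-then-Ky-K a , witnessModel , isS5 , true , holds-in-M , fails-in-Mᶠ
  where
    isS5 : IsS5KyModel Λ witnessModel
    isS5 = universalEvidence-isS5 Λ Bool total p-true-at-true true total-isEquivalence

    holds-in-M : witnessModel , true ⊨ announce-p₀-then-Ky-K a
    holds-in-M h = K⇒Ky-under-universal-evidence (witnessModel ∣ p₀) a (K a p₀) tt (λ _ → tt)
      (true , h) K-K-p₀-after-announcement
      where
        K-K-p₀-after-announcement : (witnessModel ∣ p₀) , (true , h) ⊨ K a (K a p₀)
        K-K-p₀-after-announcement =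
          valid⇒known (witnessModel ∣ p₀) a (K a p₀) (announced-atom-known witnessModel 0 a) (true , h)

    fails-in-Mᶠ : ¬ (factive witnessModel , true ⊨ announce-p₀-then-Ky-K a)
    fails-in-Mᶠ holds =
      factive-Ky⇒prior-truth witnessModel (λ w → w ≡ true) a (K a p₀) (true , refl) (holds refl)
        (true , refl) tt (p₀-unknown a true)
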